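{- Let $A=\{a_1,\ldots,a_n\}$ be a set of positive integers with $a_1<\cdots<a_n$, let $\varepsilon\in(0,1)$ and let $\varepsilon'\in(0,1)$ satisfy $\frac{1+\varepsilon'}{1-\varepsilon'}\le 1+\varepsilon$. Let $L=\{a\in A: a\ge\varepsilon\cdot a_n\}$. Let $r_{\mathrm{opt}}$ be the optimal value of the constrained Subset Sum Ratio problem on $A$, i.e. the minimum of $\max\{\Sigma(S_1),\Sigma(S_2)\}/\min\{\Sigma(S_1),\Sigma(S_2)\}$ over all pairs of disjoint nonempty subsets $S_1,S_2\subseteq A$ with $a_n\in S_1\cup S_2$. Suppose this minimum is attained by a pair $(S_1^*,S_2^*)$ such that $S^*=S_1^*\cup S_2^*\subseteq L$ (and $a_n\in S^*$). Let $S_p\subseteq S^*$ be any $(1-\varepsilon')$-approximate solution of the Partition problem on $S^*$, and let $\overline{S_p}=S^*\setminus S_p$. Then $$\frac{\Sigma(\overline{S_p})}{\Sigma(S_p)}\le(1+\varepsilon)\cdot r_{\mathrm{opt}}.$$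
   Context: For a finite set $S$ of integers, $\Sigma(S)=\sum_{s\in S}s$. Partition problem: given a finite set $X$, an optimal solution is a subset $X^*_p\subseteq X$ with $\Sigma(X^*_p)=\max\{\Sigma(Z): Z\subseteq X,\ \Sigma(Z)\le\Sigma(X)/2\}$. For $\delta\in(0,1)$, a $(1-\delta)$-approximate solution of the Partition problem on $X$ is a subset $X_p\subseteq X$ with $(1-\delta)\cdot\Sigma(X^*_p)\le\Sigma(X_p)\le\Sigma(X^*_p)$.
   Formalization: The parameters $\varepsilon$ and $\varepsilon'$ range over the rationals. -}

module Defs where

open import Data.Nat as ℕ using (ℕ; zero; suc; _∸_)
open import Data.Integer using (+_)
open import Data.Fin using (Fin; zero; suc; fromℕ)
open import Data.Vec using ([]; _∷_)
open import Data.Bool using (true; false)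
open import Data.Product using (Σ; _×_; ∃)
open import Data.Fin.Subset using (Subset; _⊆_; _∪_; _∩_; _─_; _∈_; Nonempty; Empty)
open import Data.Rational.Unnormalised
  using (ℚᵘ; mkℚᵘ; _≤_; _*_; _-_; 1ℚᵘ)

ΣS : ∀ {n} → (Fin n → ℕ) → Subset n → ℕ
ΣS a [] = 0
ΣS a (true ∷ S) = a zero ℕ.+ ΣS (λ i → a (suc i)) S
ΣS a (false ∷ S) = ΣS (λ i → a (suc i)) S

⟦_⟧ : ℕ → ℚᵘ
⟦ m ⟧ = mkℚᵘ (+ m) 0

-- the rational x / y for naturals x, y (junk value x / 1 when y = 0; only used with y > 0)
ratio : ℕ → ℕ → ℚᵘ
ratio x y = mkℚᵘ (+ x) (y ∸ 1)

-- Partition problem on X (subsets of Fin n, element values a).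
-- Z is an optimal solution: Σ(Z) = max { Σ(W) : W ⊆ X, Σ(W) ≤ Σ(X)/2 }.
-- (Σ(W) ≤ Σ(X)/2 is written as 2·Σ(W) ≤ Σ(X) over ℕ.)
IsOptPartition : ∀ {n} → (Fin n → ℕ) → Subset n → Subset n → Set
IsOptPartition a X Z =
  Z ⊆ X × 2 ℕ.* ΣS a Z ℕ.≤ ΣS a X ×
  (∀ W → W ⊆ X → 2 ℕ.* ΣS a W ℕ.≤ ΣS a X → ΣS a W ℕ.≤ ΣS a Z)

IsApproxPartition : ∀ {n} → (Fin n → ℕ) → ℚᵘ → Subset n → Subset n → Set
IsApproxPartition a δ X Xp =
  Xp ⊆ X × ∃ λ Z → IsOptPartition a X Z ×
    ((1ℚᵘ - δ) * ⟦ ΣS a Z ⟧ ≤ ⟦ ΣS a Xp ⟧) × (ΣS a Xp ℕ.≤ ΣS a Z)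

-- Feasible pair for the constrained Subset Sum Ratio problem on A (indices Fin (suc n),
-- a_n = a (fromℕ n)): disjoint, nonempty, a_n ∈ S₁ ∪ S₂.
Feasible : ∀ {n} → Subset (suc n) → Subset (suc n) → Set
Feasible {n} S₁ S₂ = Empty (S₁ ∩ S₂) × Nonempty S₁ × Nonempty S₂ × fromℕ n ∈ (S₁ ∪ S₂)

SSR : ∀ {n} → (Fin n → ℕ) → Subset n → Subset n → ℚᵘ
SSR a S₁ S₂ = ratio (ℕ._⊔_ (ΣS a S₁) (ΣS a S₂)) (ℕ._⊓_ (ΣS a S₁) (ΣS a S₂))

InL : ∀ {n} → (Fin (suc n) → ℕ) → ℚᵘ → Fin (suc n) → Set
InL {n} a ε i = ε * ⟦ a (fromℕ n) ⟧ ≤ ⟦ a i ⟧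

{-# OPTIONS --safe #-}
-- Let M ≥ m be the two part sums of the optimal pair, so Σ(S*) = M + m, and let p = Σ(S_p).
-- The smaller part is a feasible solution of the Partition problem on S*, so the optimum is
-- at least m and hence p ≥ (1 − ε′) m. Therefore
--   Σ(S* ∖ S_p) / p = (M + m) / p − 1 ≤ (M + m) / ((1 − ε′) m) − 1,
-- and after clearing denominators this is at most (1 + ε) M / m because
-- M + ε′ m ≤ (1 + ε′) M ≤ (1 + ε)(1 − ε′) M.
module Submission where

open import Defs
open import Data.Nat as ℕ using (ℕ; suc)
open import Data.Fin using (Fin)
open import Data.Product using (_,_)
open import Data.Fin.Subset using (Subset; _⊆_; _∪_; _─_; _∈_)
open import Relation.Binary.PropositionalEquality

module SubsetSum where
  open import Data.Nat using (_+_; _*_; _≤_; _<_; _⊓_; _⊔_)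
  open import Data.Nat.Properties
  open import Data.Fin using (zero; suc)
  open import Data.Vec using ([]; _∷_; here; there)
  open import Data.Bool using (true; false)
  open import Data.Sum using (inj₁; inj₂; [_,_]′)
  open import Data.Empty using (⊥-elim)
  open import Data.Fin.Subset using (_∩_; Empty; Nonempty)
  open import Data.Fin.Subset.Properties using (drop-∷-⊆; drop-∷-Empty; p⊆p∪q; q⊆p∪q)
  open import Algebra.Properties.CommutativeSemigroup +-commutativeSemigroup using (x∙yz≈y∙xz)

  m⊔n+m⊓n≡m+n : ∀ m n → m ⊔ n + m ⊓ n ≡ m + n
  m⊔n+m⊓n≡m+n m n with ≤-total m n
  ... | inj₁ m≤n rewrite m≤n⇒m⊔n≡n m≤n | m≤n⇒m⊓n≡m m≤n = +-comm n m
  ... | inj₂ n≤m rewrite m≥n⇒m⊔n≡m n≤m | m≥n⇒m⊓n≡n n≤m = refl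

  2*[m⊓n]≤m+n : ∀ m n → 2 * (m ⊓ n) ≤ m + n
  2*[m⊓n]≤m+n m n = +-mono-≤ (m⊓n≤m m n) (≤-trans (≤-reflexive (+-identityʳ (m ⊓ n))) (m⊓n≤n m n))

  ΣS-∪ : ∀ {n} (a : Fin n → ℕ) {p q : Subset n} → Empty (p ∩ q) → ΣS a (p ∪ q) ≡ ΣS a p + ΣS a q
  ΣS-∪ a {[]}        {[]}        _     = refl
  ΣS-∪ a {true ∷ p}  {true ∷ q}  empty = ⊥-elim (empty (zero , here))
  ΣS-∪ a {true ∷ p}  {false ∷ q} empty =
    trans (cong (a zero +_) (ΣS-∪ _ {p} {q} (drop-∷-Empty empty))) (sym (+-assoc (a zero) _ _))
  ΣS-∪ a {false ∷ p} {true ∷ q}  empty =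
    trans (cong (a zero +_) (ΣS-∪ _ {p} {q} (drop-∷-Empty empty))) (x∙yz≈y∙xz (a zero) (ΣS _ p) (ΣS _ q))
  ΣS-∪ a {false ∷ p} {false ∷ q} empty = ΣS-∪ _ {p} {q} (drop-∷-Empty empty)

  ΣS-─ : ∀ {n} (a : Fin n → ℕ) {s q : Subset n} → q ⊆ s → ΣS a (s ─ q) + ΣS a q ≡ ΣS a s
  ΣS-─ a {[]}        {[]}        _   = refl
  ΣS-─ a {true ∷ s}  {true ∷ q}  q⊆s =
    trans (x∙yz≈y∙xz (ΣS _ (s ─ q)) (a zero) _) (cong (a zero +_) (ΣS-─ _ {s} {q} (drop-∷-⊆ q⊆s)))
  ΣS-─ a {true ∷ s}  {false ∷ q} q⊆s =
    trans (+-assoc (a zero) _ _) (cong (a zero +_) (ΣS-─ _ {s} {q} (drop-∷-⊆ q⊆s)))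
  ΣS-─ a {false ∷ s} {true ∷ q}  q⊆s with q⊆s here
  ... | ()
  ΣS-─ a {false ∷ s} {false ∷ q} q⊆s = ΣS-─ _ {s} {q} (drop-∷-⊆ q⊆s)

  ΣS-pos : ∀ {n} (a : Fin n → ℕ) → (∀ i → 0 < a i) → ∀ {p} → Nonempty p → 0 < ΣS a p
  ΣS-pos a a>0 {true ∷ p}  _                 = <-≤-trans (a>0 zero) (m≤m+n _ _)
  ΣS-pos a a>0 {false ∷ p} (suc i , there i∈p) = ΣS-pos _ (λ i → a>0 (suc i)) (i , i∈p)

  ΣS⊓ΣS≤optimum : ∀ {n} (a : Fin n → ℕ) {S₁ S₂ Z : Subset n} → Empty (S₁ ∩ S₂) →
    IsOptPartition a (S₁ ∪ S₂) Z → ΣS a S₁ ⊓ ΣS a S₂ ≤ ΣS a Z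
  ΣS⊓ΣS≤optimum a {S₁} {S₂} {Z} disjoint (_ , _ , optimal) =
    [ bounded-by S₁ (p⊆p∪q S₂) , bounded-by S₂ (q⊆p∪q S₁ S₂) ]′ (⊓-sel (ΣS a S₁) (ΣS a S₂))
    where
    min : ℕ
    min = ΣS a S₁ ⊓ ΣS a S₂
    twice-min≤total : 2 * min ≤ ΣS a (S₁ ∪ S₂)
    twice-min≤total = subst (2 * min ≤_) (sym (ΣS-∪ a disjoint)) (2*[m⊓n]≤m+n (ΣS a S₁) (ΣS a S₂))
    bounded-by : ∀ T → T ⊆ S₁ ∪ S₂ → min ≡ ΣS a T → min ≤ ΣS a Z
    bounded-by T T⊆S min≡ΣT = subst (_≤ ΣS a Z) (sym min≡ΣT)
      (optimal T T⊆S (subst (λ k → 2 * k ≤ _) min≡ΣT twice-min≤total))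

module CrossMultiplication where
  open import Data.Integer
    using (ℤ; +_; +[1+_]; 0ℤ; +≤+; +<+; _*_; _+_; _-_; -_; _≤_; _<_; NonNegative; nonNegative; positive)
  open import Data.Integer.Properties
  open import Data.Integer.Tactic.RingSolver
  open import Data.List using ([]; _∷_)
  open import Data.Rational.Unnormalised as ℚ using (ℚᵘ; mkℚᵘ; ↥_; ↧_; 0ℚᵘ; 1ℚᵘ; *≤*)
  open import Data.Rational.Unnormalised.Properties using (drop-*≤*; drop-*<*)

  i<j⇒0<j-i : ∀ {i j} → i < j → 0ℤ < j - i
  i<j⇒0<j-i {i} {j} i<j = begin-strict
    0ℤ     ≡⟨ +-inverseʳ i ⟨
    i - i  <⟨ +-monoˡ-< (- i) i<j ⟩
    j - i  ∎
    where open ≤-Reasoning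

  -- ε′ = e / E and c = C / K; the bound is multiplied through by E − e > 0.
  cross-bound : ∀ {C K e E X P M m : ℤ} →
    .{{_ : NonNegative K}} → .{{_ : NonNegative e}} → .{{_ : NonNegative m}} → .{{_ : NonNegative P}} →
    e < E → m ≤ M → (E + e) * K ≤ C * (E - e) → (E - e) * m ≤ E * P → X + P ≡ M + m →
    X * (K * m) ≤ C * M * P
  cross-bound {C} {K} {e} {E} {X} {P} {M} {m} e<E m≤M c-bound p-bound sum =
    *-cancelˡ-≤-pos _ _ (E - e) {{positive (i<j⇒0<j-i e<E)}} (begin
      (E - e) * (X * (K * m))                          ≡⟨ cong (λ y → (E - e) * (y * (K * m))) X≡M+m-P ⟩
      (E - e) * ((M + m - P) * (K * m))                ≡⟨ solve (E ∷ e ∷ K ∷ M ∷ m ∷ P ∷ []) ⟩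
      (M + m) * (K * ((E - e) * m)) - P * K * ((E - e) * m)
        ≤⟨ +-monoˡ-≤ _ (*-monoˡ-≤-nonNeg (M + m) (*-monoˡ-≤-nonNeg K p-bound)) ⟩
      (M + m) * (K * (E * P)) - P * K * ((E - e) * m)  ≡⟨ solve (E ∷ e ∷ K ∷ M ∷ m ∷ P ∷ []) ⟩
      P * (K * (E * M + e * m))
        ≤⟨ *-monoˡ-≤-nonNeg P (*-monoˡ-≤-nonNeg K (+-monoʳ-≤ (E * M) (*-monoˡ-≤-nonNeg e m≤M))) ⟩
      P * (K * (E * M + e * M))                        ≡⟨ solve (E ∷ e ∷ K ∷ M ∷ P ∷ []) ⟩
      P * (M * ((E + e) * K))                          ≤⟨ *-monoˡ-≤-nonNeg P (*-monoˡ-≤-nonNeg M c-bound) ⟩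
      P * (M * (C * (E - e)))                          ≡⟨ solve (C ∷ E ∷ e ∷ M ∷ P ∷ []) ⟩
      (E - e) * (C * M * P)                            ∎)
    where
    open ≤-Reasoning
    0≤M : 0ℤ ≤ M
    0≤M = ≤-trans (nonNegative⁻¹ m) m≤M
    instance
      _ : NonNegative M
      _ = nonNegative 0≤M
      _ : NonNegative (M + m)
      _ = nonNegative (+-mono-≤ 0≤M (nonNegative⁻¹ m))
    X≡M+m-P : X ≡ M + m - P
    X≡M+m-P = begin-equality
      X          ≡⟨ solve (X ∷ P ∷ []) ⟩
      X + P - P  ≡⟨ cong (_- P) sum ⟩
      M + m - P  ∎

  -- ratio x 0 is the junk value x / 1, hence the positivity assumptions.
  ratio-≤-*-ratio : ∀ {c : ℚᵘ} {x p M m : ℕ} → 0 ℕ.< p → 0 ℕ.< m →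
    + x * (↧ c * + m) ≤ ↥ c * + M * + p → ratio x p ℚ.≤ c ℚ.* ratio M m
  ratio-≤-*-ratio {mkℚᵘ _ _} {p = suc _} {m = suc _} _ _ h = *≤* h

  ⟦⟧-mono-≤ : ∀ {m n} → m ℕ.≤ n → ⟦ m ⟧ ℚ.≤ ⟦ n ⟧
  ⟦⟧-mono-≤ m≤n = *≤* (*-monoʳ-≤-nonNeg (+ 1) (+≤+ m≤n))

  ratio-bound : ∀ {c q : ℚᵘ} {x p M m : ℕ} →
    0ℚᵘ ℚ.≤ q → q ℚ.< 1ℚᵘ → 1ℚᵘ ℚ.+ q ℚ.≤ c ℚ.* (1ℚᵘ ℚ.- q) →
    0 ℕ.< m → m ℕ.≤ M → (1ℚᵘ ℚ.- q) ℚ.* ⟦ m ⟧ ℚ.≤ ⟦ p ⟧ → x ℕ.+ p ≡ M ℕ.+ m →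
    ratio x p ℚ.≤ c ℚ.* ratio M m
  ratio-bound {mkℚᵘ C k} {mkℚᵘ e j} {x} {p} {M} {m} 0≤q q<1 c-bound 0<m m≤M p-bound sum =
    ratio-≤-*-ratio {mkℚᵘ C k} 0<p 0<m
      (cross-bound {C = C} {X = + x} {{_}} {{ℚ.nonNegative 0≤q}} e<E (+≤+ m≤M) c-bound′ p-bound′ (cong +_ sum))
    where
    open ≤-Reasoning
    E K : ℤ
    E = +[1+ j ]
    K = +[1+ k ]
    e<E : e < E
    e<E = ≤-<-trans (≤-reflexive (sym (*-identityʳ e)))
            (<-≤-trans (drop-*<* q<1) (≤-reflexive (*-identityˡ E)))
    c-bound′ : (E + e) * K ≤ C * (E - e)
    c-bound′ = *-cancelˡ-≤-pos _ _ E (begin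
      E * ((E + e) * K)                          ≡⟨ lhs E e K ⟩
      (+ 1 * E + e * + 1) * (K * (+ 1 * E))      ≤⟨ drop-*≤* c-bound ⟩
      (C * (+ 1 * E + (- e) * + 1)) * (+ 1 * E)  ≡⟨ rhs C E e ⟩
      E * (C * (E - e))                          ∎)
      where
      lhs : ∀ E e K → E * ((E + e) * K) ≡ (+ 1 * E + e * + 1) * (K * (+ 1 * E))
      lhs = solve-∀
      rhs : ∀ C E e → (C * (+ 1 * E + (- e) * + 1)) * (+ 1 * E) ≡ E * (C * (E - e))
      rhs = solve-∀
    p-bound′ : (E - e) * + m ≤ E * + p
    p-bound′ = begin
      (E - e) * + m                              ≡⟨ lhs E e (+ m) ⟩
      ((+ 1 * E + (- e) * + 1) * + m) * + 1      ≤⟨ drop-*≤* p-bound ⟩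
      + p * ((+ 1 * E) * + 1)                    ≡⟨ rhs E (+ p) ⟩
      E * + p                                    ∎
      where
      lhs : ∀ E e m → (E - e) * m ≡ ((+ 1 * E + (- e) * + 1) * m) * + 1
      lhs = solve-∀
      rhs : ∀ E p → p * ((+ 1 * E) * + 1) ≡ E * p
      rhs = solve-∀
    0<p : 0 ℕ.< p
    0<p = drop‿+<+ (*-cancelˡ-<-nonNeg E (begin-strict
      E * 0ℤ         ≡⟨ *-zeroʳ E ⟩
      0ℤ             ≡⟨ *-zeroˡ (+ m) ⟨
      0ℤ * + m       <⟨ *-monoʳ-<-pos (+ m) {{positive (+<+ 0<m)}} (i<j⇒0<j-i e<E) ⟩
      (E - e) * + m  ≤⟨ p-bound′ ⟩
      E * + p        ∎))

open SubsetSum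
open CrossMultiplication
open import Data.Nat.Properties using (m⊓n≤m⊔n; ⊓-glb)
open import Data.Rational.Unnormalised using (ℚᵘ; _≤_; _<_; _*_; _+_; _-_; 0ℚᵘ; 1ℚᵘ; nonNegative)
open import Data.Rational.Unnormalised.Properties using (≤-trans; <⇒≤; *-monoʳ-≤-nonNeg; p≤q⇒0≤q-p)

lemma2 : (n : ℕ) (a : Fin (suc n) → ℕ) →
    (∀ i → 0 ℕ.< a i) →
    (∀ i j → i Data.Fin.< j → a i ℕ.< a j) →
    (ε ε′ : ℚᵘ) → 0ℚᵘ < ε → ε < 1ℚᵘ → 0ℚᵘ < ε′ → ε′ < 1ℚᵘ →
    1ℚᵘ + ε′ ≤ (1ℚᵘ + ε) * (1ℚᵘ - ε′) →
    (S₁* S₂* : Subset (suc n)) →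
    Feasible S₁* S₂* →
    (∀ T₁ T₂ → Feasible T₁ T₂ → SSR a S₁* S₂* ≤ SSR a T₁ T₂) →
    (∀ i → i ∈ (S₁* ∪ S₂*) → InL a ε i) →
    (Sp : Subset (suc n)) →
    IsApproxPartition a ε′ (S₁* ∪ S₂*) Sp →
    ratio (ΣS a ((S₁* ∪ S₂*) ─ Sp)) (ΣS a Sp) ≤ (1ℚᵘ + ε) * SSR a S₁* S₂*
lemma2 n a a>0 _ ε ε′ _ _ 0<ε′ ε′<1 ε′-bound S₁* S₂* (disjoint , S₁*≢∅ , S₂*≢∅ , _) _ _ Sp
  (Sp⊆S* , Z , Z-optimal , Sp-approx , _) =
  ratio-bound {c = 1ℚᵘ + ε} (<⇒≤ 0<ε′) ε′<1 ε′-bound 0<min (m⊓n≤m⊔n s₁ s₂) Sp≥δ·min sum-split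
  where
  s₁ s₂ : ℕ
  s₁ = ΣS a S₁*
  s₂ = ΣS a S₂*
  0<min : 0 ℕ.< s₁ ℕ.⊓ s₂
  0<min = ⊓-glb (ΣS-pos a a>0 S₁*≢∅) (ΣS-pos a a>0 S₂*≢∅)
  Sp≥δ·min : (1ℚᵘ - ε′) * ⟦ s₁ ℕ.⊓ s₂ ⟧ ≤ ⟦ ΣS a Sp ⟧
  Sp≥δ·min = ≤-trans
    (*-monoʳ-≤-nonNeg (1ℚᵘ - ε′) {{nonNegative (p≤q⇒0≤q-p (<⇒≤ ε′<1))}}
      (⟦⟧-mono-≤ (ΣS⊓ΣS≤optimum a disjoint Z-optimal)))
    Sp-approx
  sum-split : ΣS a ((S₁* ∪ S₂*) ─ Sp) ℕ.+ ΣS a Sp ≡ s₁ ℕ.⊔ s₂ ℕ.+ s₁ ℕ.⊓ s₂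
  sum-split = trans (ΣS-─ a Sp⊆S*) (trans (ΣS-∪ a disjoint) (sym (m⊔n+m⊓n≡m+n s₁ s₂)))
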